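{- Let $m\geq 2$ be an integer and let $F\in\mathbb{Z}[x_1,\dots,x_n]$ be a homogeneous polynomial of degree $k\geq 2$. Suppose that every $\mathbf{x}\in\mathbb{Z}^n$ with $F(\mathbf{x})\equiv 0\pmod{m^k}$ satisfies $\mathbf{x}\equiv\mathbf{0}\pmod m$. Let $R'\subseteq\{0,1,\dots,m^k-1\}$ be a set such that for all distinct $r,r'\in R'$, $r-r'$ is not congruent modulo $m^k$ to any element of $F(\mathbb{Z}^n)$. Let $\gamma=\frac{\log_m|R'|}{k}$. Then there is a constant $c>0$ depending only on $m$ and $k$ such that for every positive integer $N$ there exists a set $A\subseteq[N]$ with $(A-A)\cap F(\mathbb{Z}^n)=\{0\}$ and $|A|\geq cN^{\gamma}$.
   Context: $[N]=\{1,2,\dots,N\}$; $A-A=\{a-a':a,a'\in A\}$; $F(\mathbb{Z}^n)=\{F(\mathbf{x}):\mathbf{x}\in\mathbb{Z}^n\}$; $\mathbf{x}\equiv\mathbf{0}\pmod m$ means every coordinate is divisible by $m$. -}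

module Defs where

open import Data.Nat as ℕ using (ℕ; suc; _≤_; _<_; _^_)
open import Data.Integer as ℤ using (ℤ; +_)
open import Data.Integer.Divisibility using (_∣_)
open import Data.Fin using (Fin)
open import Data.Vec using (Vec; lookup; zipWith; foldr)
open import Data.List using (List; length; []; _∷_)
open import Data.List.Membership.Propositional using (_∈_)
open import Data.List.Relation.Unary.All using (All)
open import Data.Product using (_×_; _,_; proj₁; proj₂; ∃)
open import Relation.Binary.PropositionalEquality using (_≡_)

-- A polynomial in ℤ[x₁,…,xₙ], given as a finite list of terms
-- (coefficient, exponent vector).  Repeated / cancelling terms are allowed;
-- the polynomial is the sum of its terms.
Poly : ℕ → Set
Poly n = List (ℤ × Vec ℕ n)

mdeg : ∀ {n} → Vec ℕ n → ℕ
mdeg = foldr _ ℕ._+_ 0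

Homogeneous : ∀ {n} → ℕ → Poly n → Set
Homogeneous k F = All (λ t → mdeg (proj₂ t) ≡ k) F

monoVal : ∀ {n} → Vec ℕ n → Vec ℤ n → ℤ
monoVal e x = foldr _ ℤ._*_ (+ 1) (zipWith ℤ._^_ x e)

eval : ∀ {n} → Poly n → Vec ℤ n → ℤ
eval [] x = + 0
eval ((c , e) ∷ F) x = (c ℤ.* monoVal e x) ℤ.+ eval F x

VecDivBy : ∀ {n} → ℕ → Vec ℤ n → Set
VecDivBy {n} m x = (i : Fin n) → (+ m) ∣ lookup x i

InImage : ∀ {n} → Poly n → ℤ → Set
InImage {n} F z = ∃ λ (x : Vec ℤ n) → eval F x ≡ z

CongToImage : ∀ {n} → ℕ → Poly n → ℤ → Set
CongToImage {n} M F z = ∃ λ (x : Vec ℤ n) → (+ M) ∣ (z ℤ.- eval F x)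

-- Integer-only encoding of the real inequality  N ^ (log_m r) ≤ Z
-- (for m ≥ 2, N ≥ 1).  Since N^(log_m r) = r^(log_m N) and
-- log_m N = sup { p/q : q ≥ 1, m^p ≤ N^q }, the inequality holds iff
-- for all p, q with q ≥ 1:  m^p ≤ N^q  implies  r^p ≤ Z^q.
PowLogLe : (m r N Z : ℕ) → Set
PowLogLe m r N Z = (p q : ℕ) → 1 ≤ q → m ^ p ≤ N ^ q → r ^ p ≤ Z ^ q

{-# OPTIONS --safe #-}
module Submission where

-- Put M = mᵏ and let A be the set of numbers whose L base-M digits all lie
-- in R′, where M^L ≤ N < M^(L+1); then |A| = |R′|^L > N^(log_M |R′|) / |R′|,
-- and |R′| ≤ M gives the bound with C = mᵏ.
-- If F(x) = a − a′ for a, a′ ∈ A, compare the lowest digits r, r′: F(x) ≡ r − r′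
-- (mod M) forces r = r′ by the hypothesis on R′.  Then M ∣ F(x), so m ∣ x by
-- the hypothesis on F, and homogeneity gives F(x/m) = (a − a′)/M, a difference
-- of two numbers of A with one digit fewer; induction on L concludes.

open import Defs
open import Data.Nat using (ℕ; _≤_; _<_; _^_; _*_)
open import Data.Integer using (ℤ; +_; _-_)
open import Data.Integer.Divisibility using (_∣_)
open import Data.Vec using (Vec)
open import Data.List using (List; length)
open import Data.List.Membership.Propositional using (_∈_)
open import Data.List.Relation.Unary.All using (All)
open import Data.List.Relation.Unary.Unique.Propositional using (Unique)
open import Data.Product using (Σ; ∃; _×_)
open import Relation.Binary.PropositionalEquality using (_≡_; _≢_)
open import Data.Empty using (⊥)

open import Data.Nat using (zero; suc; _+_; NonZero; >-nonZero; z≤n; s≤s)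
open import Data.Nat.Properties
open import Data.Nat.DivMod using (_%_; [m+kn]%n≡m%n; m<n⇒m%n≡m)
import Data.Integer as ℤ
import Data.Integer.Properties as ℤ
import Data.Integer.Divisibility.Signed as Signed
open import Data.Integer.Tactic.RingSolver using (solve-∀)
open import Data.Vec using ([]; _∷_; map)
open import Data.List using ([]; _∷_; [_]; cartesianProductWith; _++_; lookup)
import Data.List as List
import Data.List.Properties as List
open import Data.List.Relation.Unary.Any using (here)
import Data.List.Relation.Unary.All as All
import Data.List.Relation.Unary.All.Properties as All
import Data.List.Relation.Unary.Unique.Propositional.Properties as Unique
open import Data.List.Relation.Unary.All using ([]; _∷_)
open import Data.List.Relation.Unary.AllPairs using ([]; _∷_)
open import Data.List.Membership.Propositional.Properties
  using (∈-map⁻; ∈-cartesianProductWith⁻; ∈-lookup)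
import Data.Fin as Fin
open import Data.Fin using (Fin; toℕ; fromℕ<)
open import Data.Fin.Properties using (injective⇒≤; toℕ-fromℕ<)
open import Data.Product using (_,_; proj₁; proj₂)
open import Data.Empty using (⊥-elim)
open import Relation.Nullary using (yes; no; ¬_)
open import Relation.Binary.PropositionalEquality
  using (refl; sym; trans; cong; cong₂; subst; module ≡-Reasoning)
open import Algebra.Properties.CommutativeSemigroup ℤ.*-commutativeSemigroup
  using () renaming (interchange to *-interchange)

pos-^ : ∀ m k → + (m ^ k) ≡ (+ m) ℤ.^ k
pos-^ m zero    = refl
pos-^ m (suc k) = trans (ℤ.pos-* m (m ^ k)) (cong (+ m ℤ.*_) (pos-^ m k))

^-distribʳ-* : ∀ (a b : ℤ) n → (a ℤ.* b) ℤ.^ n ≡ a ℤ.^ n ℤ.* b ℤ.^ n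
^-distribʳ-* a b zero    = refl
^-distribʳ-* a b (suc n) = begin
  a ℤ.* b ℤ.* (a ℤ.* b) ℤ.^ n           ≡⟨ cong (a ℤ.* b ℤ.*_) (^-distribʳ-* a b n) ⟩
  a ℤ.* b ℤ.* (a ℤ.^ n ℤ.* b ℤ.^ n)     ≡⟨ *-interchange a b (a ℤ.^ n) (b ℤ.^ n) ⟩
  a ℤ.* a ℤ.^ n ℤ.* (b ℤ.* b ℤ.^ n)     ∎
  where open ≡-Reasoning

monoVal-scale : ∀ {n} (c : ℤ) (e : Vec ℕ n) (y : Vec ℤ n) →
  monoVal e (map (c ℤ.*_) y) ≡ c ℤ.^ mdeg e ℤ.* monoVal e y
monoVal-scale c []       []       = refl
monoVal-scale c (i ∷ e) (y₀ ∷ y) = begin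
  (c ℤ.* y₀) ℤ.^ i ℤ.* monoVal e (map (c ℤ.*_) y)
    ≡⟨ cong₂ ℤ._*_ (^-distribʳ-* c y₀ i) (monoVal-scale c e y) ⟩
  c ℤ.^ i ℤ.* y₀ ℤ.^ i ℤ.* (c ℤ.^ mdeg e ℤ.* monoVal e y)
    ≡⟨ *-interchange (c ℤ.^ i) (y₀ ℤ.^ i) (c ℤ.^ mdeg e) (monoVal e y) ⟩
  c ℤ.^ i ℤ.* c ℤ.^ mdeg e ℤ.* (y₀ ℤ.^ i ℤ.* monoVal e y)
    ≡⟨ cong (ℤ._* _) (sym (ℤ.^-distribˡ-+-* c i (mdeg e))) ⟩
  c ℤ.^ (i + mdeg e) ℤ.* (y₀ ℤ.^ i ℤ.* monoVal e y) ∎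
  where open ≡-Reasoning

eval-homogeneous : ∀ {n} k {F : Poly n} → Homogeneous k F → (c : ℤ) (y : Vec ℤ n) →
  eval F (map (c ℤ.*_) y) ≡ c ℤ.^ k ℤ.* eval F y
eval-homogeneous k {[]}          []         c y = sym (ℤ.*-zeroʳ (c ℤ.^ k))
eval-homogeneous k {(a , e) ∷ F} (refl ∷ h) c y = begin
  a ℤ.* monoVal e (map (c ℤ.*_) y) ℤ.+ eval F (map (c ℤ.*_) y)
    ≡⟨ cong₂ (λ u v → a ℤ.* u ℤ.+ v) (monoVal-scale c e y) (eval-homogeneous k h c y) ⟩
  a ℤ.* (c ℤ.^ k ℤ.* monoVal e y) ℤ.+ c ℤ.^ k ℤ.* eval F y
    ≡⟨ factor a (c ℤ.^ k) (monoVal e y) (eval F y) ⟩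
  c ℤ.^ k ℤ.* (a ℤ.* monoVal e y ℤ.+ eval F y) ∎
  where
  open ≡-Reasoning
  factor : ∀ a d u v → a ℤ.* (d ℤ.* u) ℤ.+ d ℤ.* v ≡ d ℤ.* (a ℤ.* u ℤ.+ v)
  factor = solve-∀

VecDivBy⇒scaled : ∀ {n} m (x : Vec ℤ n) → VecDivBy m x → ∃ λ y → x ≡ map (+ m ℤ.*_) y
VecDivBy⇒scaled m []      _   = [] , refl
VecDivBy⇒scaled m (x₀ ∷ x) m∣x
  with Signed.∣ᵤ⇒∣ {+ m} {x₀} (m∣x Fin.zero) | VecDivBy⇒scaled m x (λ i → m∣x (Fin.suc i))
... | Signed.divides q refl | y , refl = q ∷ y , cong (_∷ _) (ℤ.*-comm q (+ m))

InImage-descent : ∀ {n} m k .{{_ : NonZero m}} {F : Poly n} → Homogeneous k F →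
  ((x : Vec ℤ n) → + (m ^ k) ∣ eval F x → VecDivBy m x) →
  ∀ E → InImage F (E ℤ.* + (m ^ k)) → InImage F E
InImage-descent m k {F} hom hyp E (x , Fx≡EM)
  with VecDivBy⇒scaled m x (hyp x (Signed.∣⇒∣ᵤ (Signed.divides E Fx≡EM)))
... | y , refl = y , ℤ.*-cancelˡ-≡ (+ (m ^ k)) (eval F y) E {{m^n≢0 m k}} (begin
  + (m ^ k) ℤ.* eval F y              ≡⟨ cong (ℤ._* eval F y) (pos-^ m k) ⟩
  (+ m) ℤ.^ k ℤ.* eval F y           ≡⟨ eval-homogeneous k hom (+ m) y ⟨
  eval F (map (+ m ℤ.*_) y)          ≡⟨ Fx≡EM ⟩
  E ℤ.* + (m ^ k)                    ≡⟨ ℤ.*-comm E (+ (m ^ k)) ⟩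
  + (m ^ k) ℤ.* E                    ∎)
  where open ≡-Reasoning

length-cartesianProductWith : ∀ {A B C : Set} (f : A → B → C) xs ys →
  length (cartesianProductWith f xs ys) ≡ length xs * length ys
length-cartesianProductWith f []       ys = refl
length-cartesianProductWith f (x ∷ xs) ys = begin
  length (List.map (f x) ys ++ cartesianProductWith f xs ys)
    ≡⟨ List.length-++ (List.map (f x) ys) ⟩
  length (List.map (f x) ys) + length (cartesianProductWith f xs ys)
    ≡⟨ cong₂ _+_ (List.length-map (f x) ys) (length-cartesianProductWith f xs ys) ⟩
  length ys + length xs * length ys ∎
  where open ≡-Reasoning

Unique-cartesianProductWith⁺ : ∀ {A B C : Set} {P : A → Set} (f : A → B → C) →
  (∀ {w x y z} → P w → P x → f w y ≡ f x z → w ≡ x × y ≡ z) →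
  ∀ {xs ys} → All P xs → Unique xs → Unique ys → Unique (cartesianProductWith f xs ys)
Unique-cartesianProductWith⁺ f f-inj []         []          _  = []
Unique-cartesianProductWith⁺ f f-inj {x ∷ xs} {ys} (px ∷ pxs) (x∉xs ∷ xs!) ys! =
  Unique.++⁺ (Unique.map⁺ (λ eq → proj₂ (f-inj px px eq)) ys!)
             (Unique-cartesianProductWith⁺ f f-inj pxs xs! ys!) disjoint
  where
  disjoint : ∀ {v} → ¬ (v ∈ List.map (f x) ys × v ∈ cartesianProductWith f xs ys)
  disjoint (v∈ , v∈′) with ∈-map⁻ (f x) v∈ | ∈-cartesianProductWith⁻ f xs ys v∈′
  ... | _ , _ , refl | x′ , _ , x′∈xs , _ , eq =
    All.lookup x∉xs x′∈xs (proj₁ (f-inj px (All.lookup pxs x′∈xs) eq))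

module Digits (M : ℕ) .{{_ : NonZero M}} where

  infixr 5 _◃_
  _◃_ : ℕ → ℕ → ℕ
  r ◃ b = r + b * M

  ◃-injective : ∀ {r r′ b b′} → r < M → r′ < M → r ◃ b ≡ r′ ◃ b′ → r ≡ r′ × b ≡ b′
  ◃-injective {r} {r′} {b} {b′} r<M r′<M eq =
    r≡r′ , *-cancelʳ-≡ b b′ M (+-cancelˡ-≡ r _ _ (trans eq (cong (_◃ b′) (sym r≡r′))))
    where
    open ≡-Reasoning
    r≡r′ : r ≡ r′
    r≡r′ = begin
      r              ≡⟨ m<n⇒m%n≡m r<M ⟨
      r % M          ≡⟨ [m+kn]%n≡m%n r b M ⟨
      (r ◃ b) % M    ≡⟨ cong (_% M) eq ⟩
      (r′ ◃ b′) % M  ≡⟨ [m+kn]%n≡m%n r′ b′ M ⟩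
      r′ % M         ≡⟨ m<n⇒m%n≡m r′<M ⟩
      r′             ∎

  ◃-< : ∀ {r b} L → r < M → b < M ^ L → r ◃ b < M ^ suc L
  ◃-< {r} {b} L r<M b<Mᴸ = begin-strict
    r + b * M   <⟨ +-monoˡ-< (b * M) r<M ⟩
    suc b * M   ≤⟨ *-monoˡ-≤ M b<Mᴸ ⟩
    M ^ L * M   ≡⟨ *-comm (M ^ L) M ⟩
    M ^ suc L   ∎
    where open ≤-Reasoning

  ◃-difference : ∀ r b r′ b′ →
    + (r ◃ b) - + (r′ ◃ b′) ≡ (+ r - + r′) ℤ.+ (+ b - + b′) ℤ.* + M
  ◃-difference r b r′ b′ = begin
    + (r ◃ b) - + (r′ ◃ b′)
      ≡⟨ cong₂ _-_ (embed r b) (embed r′ b′) ⟩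
    (+ r ℤ.+ + b ℤ.* + M) - (+ r′ ℤ.+ + b′ ℤ.* + M)
      ≡⟨ regroup (+ r) (+ b) (+ r′) (+ b′) (+ M) ⟩
    (+ r - + r′) ℤ.+ (+ b - + b′) ℤ.* + M ∎
    where
    open ≡-Reasoning
    embed : ∀ r b → + (r ◃ b) ≡ + r ℤ.+ + b ℤ.* + M
    embed r b = trans (ℤ.pos-+ r (b * M)) (cong (ℤ._+_ (+ r)) (ℤ.pos-* b M))
    regroup : ∀ r b r′ b′ M → (r ℤ.+ b ℤ.* M) - (r′ ℤ.+ b′ ℤ.* M) ≡ (r - r′) ℤ.+ (b - b′) ℤ.* M
    regroup = solve-∀

  ◃-difference-sameDigit : ∀ r b b′ → + (r ◃ b) - + (r ◃ b′) ≡ (+ b - + b′) ℤ.* + M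
  ◃-difference-sameDigit r b b′ = trans (◃-difference r b r b′) (cancel (+ r) (+ b - + b′) (+ M))
    where
    cancel : ∀ r E M → (r - r) ℤ.+ E ℤ.* M ≡ E ℤ.* M
    cancel = solve-∀

  ◃-difference-modM : ∀ r b r′ b′ → + M ∣ (+ r - + r′) - (+ (r ◃ b) - + (r′ ◃ b′))
  ◃-difference-modM r b r′ b′ = Signed.∣⇒∣ᵤ (Signed.divides (ℤ.- (+ b - + b′)) (begin
    (+ r - + r′) - (+ (r ◃ b) - + (r′ ◃ b′))
      ≡⟨ cong ((+ r - + r′) -_) (◃-difference r b r′ b′) ⟩
    (+ r - + r′) - ((+ r - + r′) ℤ.+ (+ b - + b′) ℤ.* + M)
      ≡⟨ cancel (+ r - + r′) (+ b - + b′) (+ M) ⟩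
    ℤ.- (+ b - + b′) ℤ.* + M ∎))
    where
    open ≡-Reasoning
    cancel : ∀ d E M → d - (d ℤ.+ E ℤ.* M) ≡ ℤ.- E ℤ.* M
    cancel = solve-∀

  expansions : List ℕ → ℕ → List ℕ
  expansions D zero    = [ 0 ]
  expansions D (suc L) = cartesianProductWith _◃_ D (expansions D L)

  length-expansions : ∀ D L → length (expansions D L) ≡ length D ^ L
  length-expansions D zero    = refl
  length-expansions D (suc L) =
    trans (length-cartesianProductWith _◃_ D (expansions D L))
          (cong (length D *_) (length-expansions D L))

  expansions-< : ∀ {D} → All (_< M) D → ∀ L → All (_< M ^ L) (expansions D L)
  expansions-< D<M zero    = s≤s z≤n ∷ []
  expansions-< {D} D<M (suc L) = All.tabulate λ a∈ →
    let r , b , r∈ , b∈ , a≡r◃b = ∈-cartesianProductWith⁻ _◃_ D (expansions D L) a∈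
    in subst (_< M ^ suc L) (sym a≡r◃b)
         (◃-< L (All.lookup D<M r∈) (All.lookup (expansions-< D<M L) b∈))

  expansions-unique : ∀ {D} → All (_< M) D → Unique D → ∀ L → Unique (expansions D L)
  expansions-unique D<M D! zero    = [] ∷ []
  expansions-unique D<M D! (suc L) =
    Unique-cartesianProductWith⁺ _◃_ (λ r<M r′<M → ◃-injective r<M r′<M)
      D<M D! (expansions-unique D<M D! L)

  -- S plays the role of the image F(ℤⁿ).
  expansions-difference-free : ∀ {S : ℤ → Set} {D : List ℕ} →
    (∀ E → S (E ℤ.* + M) → S E) →
    (∀ {r r′ z} → r ∈ D → r′ ∈ D → r ≢ r′ → S z → + M ∣ (+ r - + r′) - z → ⊥) →
    ∀ L {a a′} → a ∈ expansions D L → a′ ∈ expansions D L → S (+ a - + a′) → a ≡ a′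
  expansions-difference-free S-descent D-separated zero (here refl) (here refl) _ = refl
  expansions-difference-free {S} {D} S-descent D-separated (suc L) a∈ a′∈ S[a-a′]
    with ∈-cartesianProductWith⁻ _◃_ D (expansions D L) a∈
       | ∈-cartesianProductWith⁻ _◃_ D (expansions D L) a′∈
  ... | r , b , r∈ , b∈ , refl | r′ , b′ , r′∈ , b′∈ , refl with r ≟ r′
  ...   | no r≢r′ = ⊥-elim (D-separated r∈ r′∈ r≢r′ S[a-a′] (◃-difference-modM r b r′ b′))
  ...   | yes refl = cong (r ◃_) (expansions-difference-free S-descent D-separated L b∈ b′∈
                       (S-descent _ (subst S (◃-difference-sameDigit r b b′) S[a-a′])))

lookup-injective : ∀ {A : Set} {xs : List A} → Unique xs →
  ∀ i j → lookup xs i ≡ lookup xs j → i ≡ j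
lookup-injective (x∉xs ∷ xs!) Fin.zero    Fin.zero    _  = refl
lookup-injective (x∉xs ∷ xs!) Fin.zero    (Fin.suc j) eq = ⊥-elim (All.lookup x∉xs (∈-lookup j) eq)
lookup-injective (x∉xs ∷ xs!) (Fin.suc i) Fin.zero    eq = ⊥-elim (All.lookup x∉xs (∈-lookup i) (sym eq))
lookup-injective (x∉xs ∷ xs!) (Fin.suc i) (Fin.suc j) eq = cong Fin.suc (lookup-injective xs! i j eq)

Unique-length-≤ : ∀ {M} {xs : List ℕ} → Unique xs → All (_< M) xs → length xs ≤ M
Unique-length-≤ {M} {xs} xs! xs<M = injective⇒≤ {f = index} index-injective
  where
  index : Fin (length xs) → Fin M
  index i = fromℕ< (All.lookup xs<M (∈-lookup i))
  index-injective : ∀ {i j} → index i ≡ index j → i ≡ j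
  index-injective {i} {j} eq = lookup-injective xs! i j (begin
    lookup xs i       ≡⟨ toℕ-fromℕ< _ ⟨
    toℕ (index i)     ≡⟨ cong toℕ eq ⟩
    toℕ (index j)     ≡⟨ toℕ-fromℕ< _ ⟩
    lookup xs j       ∎)
    where open ≡-Reasoning

log-bracket : ∀ {M} → 1 < M → ∀ N → 1 ≤ N → ∃ λ L → M ^ L ≤ N × N < M ^ suc L
log-bracket {M} 1<M 1             _ = 0 , ≤-refl , subst (1 <_) (sym (*-identityʳ M)) 1<M
log-bracket {M} 1<M (suc (suc N)) _ with log-bracket 1<M (suc N) (s≤s z≤n)
... | L , Mᴸ≤1+N , 1+N<M¹⁺ᴸ with suc (suc N) <? M ^ suc L
...   | yes 2+N<M¹⁺ᴸ = L , m≤n⇒m≤1+n Mᴸ≤1+N , 2+N<M¹⁺ᴸ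
...   | no  2+N≮M¹⁺ᴸ = suc L , ≮⇒≥ 2+N≮M¹⁺ᴸ , ≤-<-trans 1+N<M¹⁺ᴸ (^-monoʳ-< M 1<M (n<1+n (suc L)))

-- Both sides are compared through the exponent k(L+1)q:  mᵖ ≤ N^q < m^(k(L+1)q)
-- bounds p, and s ≤ mᵏ turns s^(L+1) into at most mᵏ sᴸ.
PowLogLe-bracket : ∀ m k s N L .{{_ : NonZero m}} →
  1 ≤ s → s ≤ m ^ k → N < (m ^ k) ^ suc L → PowLogLe m s N ((m ^ k * s ^ L) ^ k)
PowLogLe-bracket m k s N L 1≤s s≤mᵏ N<mᵏ⁽ᴸ⁺¹⁾ p q@(suc _) _ mᵖ≤Nᵠ = begin
  s ^ p                        ≤⟨ ^-monoʳ-≤ s {{>-nonZero 1≤s}} (<⇒≤ p<e) ⟩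
  s ^ (k * suc L * q)          ≡⟨ cong (λ j → s ^ (j * q)) (*-comm k (suc L)) ⟩
  s ^ (suc L * k * q)          ≡⟨ ^-*-assoc s (suc L * k) q ⟨
  (s ^ (suc L * k)) ^ q        ≡⟨ cong (_^ q) (^-*-assoc s (suc L) k) ⟨
  ((s ^ suc L) ^ k) ^ q        ≤⟨ ^-monoˡ-≤ q (^-monoˡ-≤ k (*-monoˡ-≤ (s ^ L) s≤mᵏ)) ⟩
  ((m ^ k * s ^ L) ^ k) ^ q    ∎
  where
  open ≤-Reasoning
  Nᵠ<mᵉ : N ^ q < m ^ (k * suc L * q)
  Nᵠ<mᵉ = subst (N ^ q <_)
    (trans (cong (_^ q) (^-*-assoc m k (suc L))) (^-*-assoc m (k * suc L) q))
    (^-monoˡ-< q N<mᵏ⁽ᴸ⁺¹⁾)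
  p<e : p < k * suc L * q
  p<e = ≰⇒> λ e≤p → <-irrefl refl (≤-<-trans (≤-trans (^-monoʳ-≤ m e≤p) mᵖ≤Nᵠ) Nᵠ<mᵉ)

map-suc-difference-free : ∀ {S : ℤ → Set} {E : List ℕ} →
  (∀ {b b′} → b ∈ E → b′ ∈ E → S (+ b - + b′) → b ≡ b′) →
  ∀ {a a′} → a ∈ List.map suc E → a′ ∈ List.map suc E → S (+ a - + a′) → a ≡ a′
map-suc-difference-free {S} E-free a∈ a′∈ S[a-a′]
  with ∈-map⁻ suc a∈ | ∈-map⁻ suc a′∈
... | b , b∈ , refl | b′ , b′∈ , refl = cong suc (E-free b∈ b′∈ (subst S shift S[a-a′]))
  where
  shift : + suc b - + suc b′ ≡ + b - + b′
  shift = trans (ℤ.[+m]-[+n]≡m⊖n (suc b) (suc b′))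
                (trans (ℤ.[1+m]⊖[1+n]≡m⊖n b b′) (sym (ℤ.[+m]-[+n]≡m⊖n b b′)))

theorem1p7 : (m k : ℕ) → 2 ≤ m → 2 ≤ k →
  Σ ℕ λ C → 1 ≤ C ×
    ((n : ℕ) (F : Poly n) → Homogeneous k F →
     ((x : Vec ℤ n) → (+ (m ^ k)) ∣ eval F x → VecDivBy m x) →
     (R′ : List ℕ) → Unique R′ → All (λ r → r < m ^ k) R′ → 1 ≤ length R′ →
     ((r r′ : ℕ) → r ∈ R′ → r′ ∈ R′ → r ≢ r′ →
        CongToImage (m ^ k) F ((+ r) - (+ r′)) → ⊥) →
     (N : ℕ) → 1 ≤ N →
     Σ (List ℕ) λ A → Unique A × All (λ a → 1 ≤ a × a ≤ N) A ×
       ((a a′ : ℕ) → a ∈ A → a′ ∈ A → InImage F ((+ a) - (+ a′)) → a ≡ a′) ×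
       PowLogLe m (length R′) N ((C * length A) ^ k))
theorem1p7 zero          k () _
theorem1p7 (suc zero)    k (s≤s ()) _
theorem1p7 m@(suc (suc _)) k 2≤m 2≤k = m ^ k , m^n>0 m k ,
  λ n F hom hyp R′ R′! R′<mᵏ 1≤|R′| R′-separated N 1≤N →
  let open Digits (m ^ k) {{m^n≢0 m k}}
      L , mᵏᴸ≤N , N<mᵏ⁽ᴸ⁺¹⁾ = log-bracket (^-monoʳ-< m 2≤m (≤-trans (s≤s z≤n) 2≤k)) N 1≤N
      E = expansions R′ L
  in List.map suc E
   , Unique.map⁺ suc-injective (expansions-unique R′<mᵏ R′! L)
   , All.map⁺ (All.map (λ a<mᵏᴸ → s≤s z≤n , ≤-trans a<mᵏᴸ mᵏᴸ≤N) (expansions-< R′<mᵏ L))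
   , (λ _ _ → map-suc-difference-free {InImage F}
        (expansions-difference-free (InImage-descent m k hom hyp)
          (λ r∈ r′∈ r≢r′ → λ { (x , refl) mᵏ∣ → R′-separated _ _ r∈ r′∈ r≢r′ (x , mᵏ∣) }) L))
   , subst (λ ℓ → PowLogLe m (length R′) N ((m ^ k * ℓ) ^ k))
       (sym (trans (List.length-map suc E) (length-expansions R′ L)))
       (PowLogLe-bracket m k (length R′) N L 1≤|R′| (Unique-length-≤ R′! R′<mᵏ) N<mᵏ⁽ᴸ⁺¹⁾)
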